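{- Let $k\in\mathbb N^+$ and let $G=(V,E)$ be a graph without isolated vertices. If $G$ contains an independent set of size $(k-1)^2+1$, then $G$ has a $k$-edge induced subgraph.
   Context: Graphs are simple, finite, with nonempty vertex set. A vertex is isolated if it has degree $0$. A $k$-edge induced subgraph of $G$ is $G[S]$ for some nonempty $S\subseteq V(G)$ with exactly $k$ edges. -}

module Defs where

open import Data.Nat using (ℕ; zero; suc; _+_; _*_; _∸_)
open import Data.Bool using (Bool; true; false; _∧_; if_then_else_)
open import Data.Fin using (Fin; toℕ)
open import Data.Fin.Subset using (Subset; _∈_; ∣_∣; Nonempty)
open import Data.List using (List; map; allFin)
open import Data.Nat.ListAction using (sum)
open import Data.Nat using (_<ᵇ_)
open import Data.Vec using (lookup)
open import Data.Product using (Σ; ∃; _×_; _,_)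
open import Relation.Binary.PropositionalEquality using (_≡_)
open import Relation.Nullary using (¬_)

record Graph (n : ℕ) : Set where
  field
    adj   : Fin n → Fin n → Bool
    sym   : ∀ u v → adj u v ≡ adj v u
    irrefl : ∀ v → adj v v ≡ false

open Graph public

Isolated : ∀ {n} → Graph n → Fin n → Set
Isolated G v = ∀ u → adj G v u ≡ false

Independent : ∀ {n} → Graph n → Subset n → Set
Independent G S = ∀ u v → u ∈ S → v ∈ S → adj G u v ≡ false

b2n : Bool → ℕ
b2n true = 1
b2n false = 0

-- Number of edges of the induced subgraph G[S]: the number of pairs
-- (u , v) with toℕ u < toℕ v, u, v ∈ S and u ~ v (each edge counted once).
edgesInduced : ∀ {n} → Graph n → Subset n → ℕ
edgesInduced {n} G S =
  sum (map (λ u → sum (map (λ v →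
    b2n ((toℕ u <ᵇ toℕ v) ∧ lookup S u ∧ lookup S v ∧ adj G u v))
    (allFin n))) (allFin n))

module Submission where

-- If some vertex has at least k neighbours in the independent set I, it spans a
-- star with k of them. Otherwise every vertex has at most k − 1 neighbours in I.
-- As no vertex is isolated, the vertices outside I dominate I; thinning them out
-- greedily leaves centres u₁ … uₘ, each with a private neighbour xᵢ ∈ I, and
-- since (k − 1) m ≥ |I| > (k − 1)² there are m ≥ k of them. Dropping centres one
-- at a time loses at most as many edges as centres remain, so some set U of the
-- centres has e(U) ≤ k ≤ e(U) + |U|. Each private neighbour of a centre in U
-- adds exactly one edge, so adding the right number of them gives k edges.

open import Defs renaming (sym to adj-sym)

open import Data.Bool using (Bool; true; false; T; _∧_; _∨_)
open import Data.Bool.ListAction using (any)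
open import Data.Bool.Properties using (∧-zeroʳ; ∨-zeroʳ; T?; ¬-not) renaming (_≟_ to _≟ᵇ_)
open import Data.Empty using (⊥-elim)
open import Data.Fin using (Fin; zero; suc; toℕ; _≟_; punchIn)
open import Data.Fin.Properties using (punchInᵢ≢i; toℕ-injective; any?; ¬∀⟶∃¬)
open import Data.Fin.Subset using (Subset; Nonempty; ∣_∣)
open import Data.List using (List; []; _∷_; _++_; map; length; drop; filter; filterᵇ; tabulate; allFin)
open import Data.List.Properties using (map-tabulate; length-drop; length-map; drop-map; ++-identityʳ)
open import Data.List.Membership.Propositional using (_∈_; _∉_; lose)
open import Data.List.Membership.Propositional.Properties
  using (∈-++⁺ʳ; ∈-++⁻; ∈-map⁻; ∈-filter⁺; ∈-allFin)
open import Data.List.Relation.Unary.All as All using (All; []; _∷_)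
open import Data.List.Relation.Unary.All.Properties as All using (all-filter; ¬Any⇒All¬; All¬⇒¬Any)
open import Data.List.Relation.Unary.AllPairs using (AllPairs; []; _∷_)
open import Data.List.Relation.Unary.AllPairs.Properties as AllPairs using ()
open import Data.List.Relation.Unary.Any as Any using (Any; here; there)
open import Data.List.Relation.Unary.Any.Properties as Any using ()
open import Data.List.Relation.Unary.Unique.Propositional using (Unique)
open import Data.List.Relation.Unary.Unique.Propositional.Properties as Unique using (allFin⁺)
open import Data.Nat using (ℕ; zero; suc; _+_; _*_; _∸_; _≤_; _<_; _<ᵇ_; z≤n; s≤s; z<s; s≤s⁻¹)
open import Data.Nat.ListAction using (sum)
open import Data.Nat.Properties hiding (_≟_)
open import Data.Product using (Σ; _×_; _,_; proj₁; proj₂)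
open import Data.Sum using (_⊎_; inj₁; inj₂)
open import Data.Unit using (⊤; tt)
open import Data.Vec as Vec using (lookup)
open import Data.Vec.Properties using (lookup∘tabulate; lookup⇒[]=)
open import Function using (_∘_)
open import Relation.Binary.PropositionalEquality
open import Relation.Nullary using (¬_; ¬?; Dec; does; yes; no; _×-dec_)
open import Relation.Nullary.Decidable using (dec-true; dec-false; decidable-stable)

open import Algebra.Properties.Semiring.Sum +-*-semiring
  using (sum-cong-≗; sum-replicate-zero; sum-remove; ∑-distrib-+; *-distribˡ-sum; *-distribʳ-sum)
  renaming (sum to ∑)

∑-mono-≤ : ∀ {n} {f g : Fin n → ℕ} → (∀ i → f i ≤ g i) → ∑ f ≤ ∑ g
∑-mono-≤ {zero}  f≤g = z≤n
∑-mono-≤ {suc n} f≤g = +-mono-≤ (f≤g zero) (∑-mono-≤ (f≤g ∘ suc))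

∑-zero : ∀ {n} {f : Fin n → ℕ} → (∀ i → f i ≡ 0) → ∑ f ≡ 0
∑-zero {n} f≡0 = trans (sum-cong-≗ f≡0) (sum-replicate-zero n)

∑-single : ∀ {n} {f : Fin n → ℕ} (v : Fin n) → (∀ i → i ≢ v → f i ≡ 0) → ∑ f ≡ f v
∑-single {suc n} {f} v others = begin
  ∑ f                          ≡⟨ sum-remove f ⟩
  f v + ∑ (f ∘ punchIn v)      ≡⟨ cong (f v +_) (∑-zero (λ j → others _ (punchInᵢ≢i v j))) ⟩
  f v + 0                      ≡⟨ +-identityʳ (f v) ⟩
  f v                          ∎
  where open ≡-Reasoning

sum-map-≤ : ∀ {A : Set} {f : A → ℕ} {d} → (∀ a → f a ≤ d) → ∀ xs → sum (map f xs) ≤ length xs * d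
sum-map-≤ f≤d []       = z≤n
sum-map-≤ f≤d (x ∷ xs) = +-mono-≤ (f≤d x) (sum-map-≤ f≤d xs)

[_≐_] : ∀ {n} → Fin n → Fin n → ℕ
[ a ≐ v ] = b2n (does (a ≟ v))

∑-[≐] : ∀ {n} (v : Fin n) → ∑ (λ a → [ a ≐ v ]) ≡ 1
∑-[≐] v = trans (∑-single v (λ a a≢v → cong b2n (dec-false (a ≟ v) a≢v)))
                (cong b2n (dec-true (v ≟ v) refl))

∑-[≐]* : ∀ {n} (v : Fin n) c → ∑ (λ a → [ a ≐ v ] * c) ≡ c
∑-[≐]* v c = begin
  ∑ (λ a → [ a ≐ v ] * c)  ≡⟨ sym (*-distribʳ-sum c (λ a → [ a ≐ v ])) ⟩
  ∑ (λ a → [ a ≐ v ]) * c  ≡⟨ cong (_* c) (∑-[≐] v) ⟩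
  1 * c                    ≡⟨ *-identityˡ c ⟩
  c                        ∎
  where open ≡-Reasoning

sum-tabulate : ∀ {n} (f : Fin n → ℕ) → sum (tabulate f) ≡ ∑ f
sum-tabulate {zero}  f = refl
sum-tabulate {suc n} f = cong (f zero +_) (sum-tabulate (f ∘ suc))

sum-map-allFin : ∀ {n} (f : Fin n → ℕ) → sum (map f (allFin n)) ≡ ∑ f
sum-map-allFin f = trans (cong sum (map-tabulate (λ i → i) f)) (sum-tabulate f)

true≢false : true ≢ false
true≢false ()

T-∧-≡ : ∀ {p q} → T (p ∧ q) → p ≡ true × q ≡ true
T-∧-≡ {true} {true} _ = refl , refl

b2n≤1 : ∀ b → b2n b ≤ 1
b2n≤1 true  = s≤s z≤n
b2n≤1 false = z≤n

b2n-∨∧ : ∀ p q r → b2n ((p ∨ q) ∧ r) ≤ b2n p + b2n (q ∧ r)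
b2n-∨∧ true  q r = ≤-trans (b2n≤1 r) (m≤m+n 1 _)
b2n-∨∧ false q r = ≤-refl

b2n-∧∨ : ∀ p q r → b2n (p ∧ (q ∨ r)) ≤ b2n (p ∧ q) + b2n (p ∧ r)
b2n-∧∨ false q     r = z≤n
b2n-∧∨ true  true  r = s≤s z≤n
b2n-∧∨ true  false r = ≤-refl

length-filterᵇ-tabulate : ∀ {A : Set} {m} (c : A → Bool) (f : Fin m → A) →
                          length (filterᵇ c (tabulate f)) ≡ ∑ (λ i → b2n (c (f i)))
length-filterᵇ-tabulate {m = zero}  c f = refl
length-filterᵇ-tabulate {m = suc m} c f with c (f zero)
... | true  = cong suc (length-filterᵇ-tabulate c (f ∘ suc))
... | false = length-filterᵇ-tabulate c (f ∘ suc)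

∣p∣≡∑ : ∀ {n} (p : Subset n) → ∣ p ∣ ≡ ∑ (b2n ∘ lookup p)
∣p∣≡∑ Vec.[]          = refl
∣p∣≡∑ (true  Vec.∷ p) = cong suc (∣p∣≡∑ p)
∣p∣≡∑ (false Vec.∷ p) = ∣p∣≡∑ p

<ᵇ-irrefl : ∀ m → (m <ᵇ m) ≡ false
<ᵇ-irrefl zero    = refl
<ᵇ-irrefl (suc m) = <ᵇ-irrefl m

<ᵇ-trichotomy : ∀ m n → m ≢ n →
  ((m <ᵇ n) ≡ true × (n <ᵇ m) ≡ false) ⊎ ((m <ᵇ n) ≡ false × (n <ᵇ m) ≡ true)
<ᵇ-trichotomy zero    zero    m≢n = ⊥-elim (m≢n refl)
<ᵇ-trichotomy zero    (suc n) m≢n = inj₁ (refl , refl)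
<ᵇ-trichotomy (suc m) zero    m≢n = inj₂ (refl , refl)
<ᵇ-trichotomy (suc m) (suc n) m≢n = <ᵇ-trichotomy m n (m≢n ∘ cong suc)

module EdgeCount {n} (G : Graph n) where

  edgeIndicator : (Fin n → Bool) → Fin n → Fin n → ℕ
  edgeIndicator s a b = b2n ((toℕ a <ᵇ toℕ b) ∧ s a ∧ s b ∧ adj G a b)

  edges : (Fin n → Bool) → ℕ
  edges s = ∑ λ a → ∑ λ b → edgeIndicator s a b

  neighboursIn : (Fin n → Bool) → Fin n → ℕ
  neighboursIn s v = ∑ λ b → b2n (s b ∧ adj G v b)

  insert : Fin n → (Fin n → Bool) → Fin n → Bool
  insert v s a = does (a ≟ v) ∨ s a

  edgesInduced≡edges : (S : Subset n) → edgesInduced G S ≡ edges (lookup S)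
  edgesInduced≡edges S =
    trans (sum-map-allFin {n} _) (sum-cong-≗ λ a → sum-map-allFin {n} (edgeIndicator (lookup S) a))

  edges-cong : ∀ {s s′} → (∀ a → s a ≡ s′ a) → edges s ≡ edges s′
  edges-cong s≗s′ = sum-cong-≗ λ a → sum-cong-≗ λ b →
    cong₂ (λ p q → b2n ((toℕ a <ᵇ toℕ b) ∧ p ∧ q ∧ adj G a b)) (s≗s′ a) (s≗s′ b)

  edges-∅ : edges (λ _ → false) ≡ 0
  edges-∅ = ∑-zero {n} λ a → ∑-zero {n} λ b → cong b2n (∧-zeroʳ (toℕ a <ᵇ toℕ b))

  module Insert (s : Fin n → Bool) (v : Fin n) (v∉s : s v ≡ false) where

    lowerNeighbour upperNeighbour : Fin n → ℕ
    lowerNeighbour a = b2n ((toℕ a <ᵇ toℕ v) ∧ s a ∧ adj G a v)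
    upperNeighbour b = b2n ((toℕ v <ᵇ toℕ b) ∧ s b ∧ adj G v b)

    -- The new edges are those from v to the neighbours after v (row v) and
    -- before v (column v) in the order of Fin n.
    edgeIndicator-insert : ∀ a b → edgeIndicator (insert v s) a b
      ≡ edgeIndicator s a b + ([ a ≐ v ] * upperNeighbour b + [ b ≐ v ] * lowerNeighbour a)
    edgeIndicator-insert a b with a ≟ v | b ≟ v
    ... | yes refl | yes refl rewrite <ᵇ-irrefl (toℕ v) = refl
    ... | yes refl | no _ rewrite v∉s | ∧-zeroʳ (toℕ v <ᵇ toℕ b) =
      sym (trans (+-identityʳ _) (+-identityʳ _))
    ... | no _ | yes refl rewrite v∉s | ∧-zeroʳ (s a) | ∧-zeroʳ (toℕ a <ᵇ toℕ b) =
      sym (+-identityʳ _)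
    ... | no _ | no _ = sym (+-identityʳ _)

    lower+upper : ∀ b → lowerNeighbour b + upperNeighbour b ≡ b2n (s b ∧ adj G v b)
    lower+upper b rewrite adj-sym G b v with b ≟ v
    ... | yes refl rewrite <ᵇ-irrefl (toℕ b) | v∉s = refl
    ... | no b≢v with <ᵇ-trichotomy (toℕ b) (toℕ v) (b≢v ∘ toℕ-injective)
    ... | inj₁ (b<v , v≮b) rewrite b<v | v≮b = +-identityʳ _
    ... | inj₂ (b≮v , v<b) rewrite b≮v | v<b = refl

    edges-insert : edges (insert v s) ≡ edges s + neighboursIn s v
    edges-insert = begin
      edges (insert v s)
        ≡⟨ sum-cong-≗ {n} (λ a → trans (sum-cong-≗ {n} (edgeIndicator-insert a)) (∑-distrib-+ {n} _ _)) ⟩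
      ∑ (λ a → ∑ (edgeIndicator s a) + ∑ (λ b → [ a ≐ v ] * U b + [ b ≐ v ] * L a))
        ≡⟨ ∑-distrib-+ {n} _ _ ⟩
      edges s + ∑ (λ a → ∑ (λ b → [ a ≐ v ] * U b + [ b ≐ v ] * L a))
        ≡⟨ cong (edges s +_) (sum-cong-≗ {n} λ a → ∑-distrib-+ {n} _ _) ⟩
      edges s + ∑ (λ a → ∑ (λ b → [ a ≐ v ] * U b) + ∑ (λ b → [ b ≐ v ] * L a))
        ≡⟨ cong (edges s +_) (sum-cong-≗ {n} λ a →
             cong₂ _+_ (sym (*-distribˡ-sum [ a ≐ v ] U)) (∑-[≐]* v (L a))) ⟩
      edges s + ∑ (λ a → [ a ≐ v ] * ∑ U + L a)
        ≡⟨ cong (edges s +_) (∑-distrib-+ {n} _ _) ⟩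
      edges s + (∑ (λ a → [ a ≐ v ] * ∑ U) + ∑ L)
        ≡⟨ cong (λ m → edges s + (m + ∑ L)) (∑-[≐]* v (∑ U)) ⟩
      edges s + (∑ U + ∑ L)
        ≡⟨ cong (edges s +_) (trans (+-comm (∑ U) (∑ L)) (sym (∑-distrib-+ L U))) ⟩
      edges s + ∑ (λ b → L b + U b)
        ≡⟨ cong (edges s +_) (sum-cong-≗ lower+upper) ⟩
      edges s + neighboursIn s v ∎
      where
      open ≡-Reasoning
      U L : Fin n → ℕ
      U = upperNeighbour
      L = lowerNeighbour

  open import Data.List.Membership.DecPropositional (_≟_ {n}) using (_∈?_)

  ⟦_⟧ : List (Fin n) → Fin n → Bool
  ⟦ L ⟧ v = does (v ∈? L)

  edgesOf : List (Fin n) → ℕ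
  edgesOf L = edges ⟦ L ⟧

  edgesOf-∷-∉ : ∀ {v L} → v ∉ L → edgesOf (v ∷ L) ≡ edgesOf L + neighboursIn ⟦ L ⟧ v
  edgesOf-∷-∉ {v} {L} v∉L = Insert.edges-insert ⟦ L ⟧ v (dec-false (v ∈? L) v∉L)

  edgesOf-singleton : ∀ v → edgesOf (v ∷ []) ≡ 0
  edgesOf-singleton v = trans (edgesOf-∷-∉ {v} {[]} λ ()) (cong₂ _+_ edges-∅ (∑-zero {n} λ _ → refl))

  edgesOf-∷-∈ : ∀ {v L} → v ∈ L → edgesOf (v ∷ L) ≡ edgesOf L
  edgesOf-∷-∈ {v} {L} v∈L = edges-cong absorb
    where
    absorb : ∀ a → ⟦ v ∷ L ⟧ a ≡ ⟦ L ⟧ a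
    absorb a with a ≟ v
    ... | yes refl = sym (dec-true (a ∈? L) v∈L)
    ... | no _     = refl

  neighboursIn-≤-length : ∀ v L → neighboursIn ⟦ L ⟧ v ≤ length L
  neighboursIn-≤-length v []      = ≤-reflexive (∑-zero {n} λ _ → refl)
  neighboursIn-≤-length v (y ∷ L) = begin
    neighboursIn ⟦ y ∷ L ⟧ v                          ≤⟨ ∑-mono-≤ (λ b → b2n-∨∧ (does (b ≟ y)) _ _) ⟩
    ∑ (λ b → [ b ≐ y ] + b2n (⟦ L ⟧ b ∧ adj G v b))   ≡⟨ ∑-distrib-+ {n} _ _ ⟩
    ∑ (λ b → [ b ≐ y ]) + neighboursIn ⟦ L ⟧ v        ≤⟨ +-mono-≤ (≤-reflexive (∑-[≐] y)) (neighboursIn-≤-length v L) ⟩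
    suc (length L)                                    ∎
    where open ≤-Reasoning

  edgesOf-∷-≤ : ∀ v L → edgesOf (v ∷ L) ≤ edgesOf L + length L
  edgesOf-∷-≤ v L with v ∈? L
  ... | yes v∈L = ≤-trans (≤-reflexive (edgesOf-∷-∈ v∈L)) (m≤m+n _ _)
  ... | no  v∉L = ≤-trans (≤-reflexive (edgesOf-∷-∉ v∉L)) (+-monoʳ-≤ _ (neighboursIn-≤-length v L))

  UniqueNeighbourIn : List (Fin n) → Fin n → Set
  UniqueNeighbourIn L x = Σ (Fin n) λ u →
    u ∈ L × adj G x u ≡ true × (∀ {b} → b ∈ L → adj G x b ≡ true → b ≡ u)

  neighboursIn-unique : ∀ {L x} → UniqueNeighbourIn L x → neighboursIn ⟦ L ⟧ x ≡ 1
  neighboursIn-unique {L} {x} (u , u∈L , x~u , only-u) =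
    trans (∑-single u nonNeighbour) (cong₂ (λ p q → b2n (p ∧ q)) (dec-true (u ∈? L) u∈L) x~u)
    where
    nonNeighbour : ∀ b → b ≢ u → b2n (⟦ L ⟧ b ∧ adj G x b) ≡ 0
    nonNeighbour b b≢u with b ∈? L | adj G x b in x~b
    ... | no _    | _     = refl
    ... | yes _   | false = refl
    ... | yes b∈L | true  = ⊥-elim (b≢u (only-u b∈L x~b))

  -- Reading X from right to left, each vertex is new when it is added and has
  -- exactly one neighbour among the vertices already present.
  Pendants : List (Fin n) → List (Fin n) → Set
  Pendants B []      = ⊤
  Pendants B (x ∷ X) = x ∉ X ++ B × UniqueNeighbourIn (X ++ B) x × Pendants B X

  NonAdjacent : Fin n → Fin n → Set
  NonAdjacent x y = adj G x y ≡ false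

  ¬Any-adjacent : ∀ {x L} → All (NonAdjacent x) L → ¬ Any (λ u → adj G x u ≡ true) L
  ¬Any-adjacent x≁L = All¬⇒¬Any (All.map (λ x≁u x~u → true≢false (trans (sym x~u) x≁u)) x≁L)

  pendants⁺ : ∀ B X → Unique X → AllPairs NonAdjacent X →
             All (λ x → x ∉ B × UniqueNeighbourIn B x) X → Pendants B X
  pendants⁺ B []      _              _            _ = tt
  pendants⁺ B (x ∷ X) (x∉X ∷ unique) (x≁X ∷ indep) ((x∉B , u , u∈B , x~u , only-u) ∷ attached) =
    x∉X++B , (u , ∈-++⁺ʳ X u∈B , x~u , only-u′) , pendants⁺ B X unique indep attached
    where
    x∉X++B : x ∉ X ++ B
    x∉X++B x∈ with ∈-++⁻ X x∈
    ... | inj₁ x∈X = All.lookup x∉X x∈X refl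
    ... | inj₂ x∈B = x∉B x∈B
    only-u′ : ∀ {b} → b ∈ X ++ B → adj G x b ≡ true → b ≡ u
    only-u′ b∈ x~b with ∈-++⁻ X b∈
    ... | inj₂ b∈B = only-u b∈B x~b
    ... | inj₁ b∈X with trans (sym x~b) (All.lookup x≁X b∈X)
    ...   | ()

  edgesOf-pendants : ∀ B X → Pendants B X → edgesOf (X ++ B) ≡ edgesOf B + length X
  edgesOf-pendants B []      _                  = sym (+-identityʳ _)
  edgesOf-pendants B (x ∷ X) (x∉ , x-unique , P) = begin
    edgesOf (x ∷ X ++ B)                          ≡⟨ edgesOf-∷-∉ x∉ ⟩
    edgesOf (X ++ B) + neighboursIn ⟦ X ++ B ⟧ x  ≡⟨ cong₂ _+_ (edgesOf-pendants B X P) (neighboursIn-unique x-unique) ⟩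
    edgesOf B + length X + 1                      ≡⟨ +-assoc (edgesOf B) (length X) 1 ⟩
    edgesOf B + (length X + 1)                    ≡⟨ cong (edgesOf B +_) (+-comm (length X) 1) ⟩
    edgesOf B + suc (length X)                    ∎
    where open ≡-Reasoning

  pendants-drop⁺ : ∀ i B X → Pendants B X → Pendants B (drop i X)
  pendants-drop⁺ zero    B X       P           = P
  pendants-drop⁺ (suc i) B []      _           = tt
  pendants-drop⁺ (suc i) B (x ∷ X) (_ , _ , P) = pendants-drop⁺ i B X P

  pendants-reach : ∀ {k} B X → Pendants B X → edgesOf B ≤ k → k ≤ edgesOf B + length X →
                   Σ (List (Fin n)) λ L → edgesOf L ≡ k
  pendants-reach {k} B X P lo hi = drop (length X ∸ t) X ++ B , (begin
    edgesOf (drop (length X ∸ t) X ++ B)          ≡⟨ edgesOf-pendants B _ (pendants-drop⁺ (length X ∸ t) B X P) ⟩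
    edgesOf B + length (drop (length X ∸ t) X)    ≡⟨ cong (edgesOf B +_) (length-drop (length X ∸ t) X) ⟩
    edgesOf B + (length X ∸ (length X ∸ t))       ≡⟨ cong (edgesOf B +_) (m∸[m∸n]≡n (m≤n+o⇒m∸n≤o k (edgesOf B) hi)) ⟩
    edgesOf B + t                                 ≡⟨ m+[n∸m]≡n lo ⟩
    k                                             ∎)
    where
    open ≡-Reasoning
    t : ℕ
    t = k ∸ edgesOf B

  -- Dropping the head of U loses at most length U − 1 edges, so the interval
  -- [edgesOf U, edgesOf U + length U] cannot jump over k.
  straddlingSuffix : ∀ {k} U → k ≤ edgesOf U + length U →
    Σ ℕ λ i → edgesOf (drop i U) ≤ k × k ≤ edgesOf (drop i U) + length (drop i U)
  straddlingSuffix []      hi = 0 , ≤-trans (≤-reflexive edges-∅) z≤n , hi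
  straddlingSuffix {k} (u ∷ U) hi with edgesOf (u ∷ U) ≤? k
  ... | yes lo = 0 , lo , hi
  ... | no  ≰ with straddlingSuffix U (<⇒≤ (<-≤-trans (≰⇒> ≰) (edgesOf-∷-≤ u U)))
  ...   | i , straddle = suc i , straddle

  subset-fromList : ∀ {k} L → edgesOf L ≡ suc k → Σ (Subset n) λ S → Nonempty S × edgesInduced G S ≡ suc k
  subset-fromList []      e with trans (sym edges-∅) e
  ... | ()
  subset-fromList (y ∷ L) e =
      Vec.tabulate ⟦ y ∷ L ⟧
    , (y , lookup⇒[]= y _ (trans (lookup∘tabulate ⟦ y ∷ L ⟧ y) (dec-true (y ∈? y ∷ L) (here refl))))
    , trans (edgesInduced≡edges (Vec.tabulate ⟦ y ∷ L ⟧)) (trans (edges-cong (lookup∘tabulate ⟦ y ∷ L ⟧)) e)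

module IndependentSet {n} (G : Graph n) (I : Fin n → Bool)
  (independent : ∀ u v → I u ≡ true → I v ≡ true → adj G u v ≡ false) where

  open EdgeCount G

  nonAdjacent : ∀ {X} → All (λ x → I x ≡ true) X → AllPairs NonAdjacent X
  nonAdjacent []          = []
  nonAdjacent (Ix ∷ I[X]) = All.map (independent _ _ Ix) I[X] ∷ nonAdjacent I[X]

  star-reach : ∀ {k} u → k ≤ neighboursIn I u → Σ (List (Fin n)) λ L → edgesOf L ≡ k
  star-reach {k} u k≤deg = pendants-reach (u ∷ []) X
    (pendants⁺ (u ∷ []) X (Unique.filter⁺ (T? ∘ c) (allFin⁺ n)) (nonAdjacent (All.map proj₁ attached))
                        (All.map leaf attached))
    (≤-trans (≤-reflexive (edgesOf-singleton u)) z≤n)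
    (≤-trans k≤deg (≤-trans (≤-reflexive (sym (length-filterᵇ-tabulate c (λ i → i)))) (m≤n+m _ _)))
    where
    c : Fin n → Bool
    c x = I x ∧ adj G u x
    X : List (Fin n)
    X = filterᵇ c (allFin n)
    attached : All (λ x → I x ≡ true × adj G u x ≡ true) X
    attached = All.map T-∧-≡ (all-filter (T? ∘ c) (allFin n))
    leaf : ∀ {x} → I x ≡ true × adj G u x ≡ true → x ∉ u ∷ [] × UniqueNeighbourIn (u ∷ []) x
    leaf {x} (_ , u~x) =
        (λ { (here refl) → true≢false (trans (sym u~x) (irrefl G u)) })
      , (u , here refl , trans (adj-sym G x u) u~x , λ { (here b≡u) _ → b≡u })

  -- (u , x): a centre u outside I with a neighbour x ∈ I that is adjacent to no
  -- other centre of the list.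
  Matched : Fin n × Fin n → Set
  Matched (u , x) = I x ≡ true × I u ≡ false × adj G x u ≡ true

  Private : Fin n × Fin n → Fin n × Fin n → Set
  Private (u , x) (u′ , x′) = adj G x u′ ≡ false × adj G x′ u ≡ false

  PrivateMatching : List (Fin n × Fin n) → Set
  PrivateMatching ps = All Matched ps × AllPairs Private ps

  centres leaves : List (Fin n × Fin n) → List (Fin n)
  centres = map proj₁
  leaves  = map proj₂

  leaves-unique : ∀ ps → PrivateMatching ps → Unique (leaves ps)
  leaves-unique []             _                                = []
  leaves-unique ((u , x) ∷ ps) ((_ , _ , x~u) ∷ M , priv ∷ privs) =
    All.map⁺ (All.map distinct priv) ∷ leaves-unique ps (M , privs)
    where
    distinct : ∀ {p} → Private (u , x) p → x ≢ proj₂ p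
    distinct (_ , x′≁u) refl = true≢false (trans (sym x~u) x′≁u)

  uniqueNeighbourIn-∷ : ∀ {L x u} → UniqueNeighbourIn L x → adj G x u ≡ false → UniqueNeighbourIn (u ∷ L) x
  uniqueNeighbourIn-∷ (w , w∈L , x~w , only-w) x≁u =
    w , there w∈L , x~w , λ { (here refl) x~u → ⊥-elim (true≢false (trans (sym x~u) x≁u))
                            ; (there b∈L) → only-w b∈L }

  leaves-uniqueNeighbour : ∀ ps → PrivateMatching ps →
    All (λ p → UniqueNeighbourIn (centres ps) (proj₂ p)) ps
  leaves-uniqueNeighbour []             _ = []
  leaves-uniqueNeighbour ((u , x) ∷ ps) ((_ , _ , x~u) ∷ M , priv ∷ privs) =
      (u , here refl , x~u , only-u)
    ∷ All.zipWith (λ (unique , _ , x′≁u) → uniqueNeighbourIn-∷ unique x′≁u)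
                  (leaves-uniqueNeighbour ps (M , privs) , priv)
    where
    only-u : ∀ {b} → b ∈ u ∷ centres ps → adj G x b ≡ true → b ≡ u
    only-u (here b≡u)  _ = b≡u
    only-u (there b∈U) x~b with ∈-map⁻ proj₁ b∈U
    ... | p , p∈ps , refl with trans (sym x~b) (proj₁ (All.lookup priv p∈ps))
    ...   | ()

  pendants-of-matching : ∀ ps → PrivateMatching ps → Pendants (centres ps) (leaves ps)
  pendants-of-matching ps M@(matched , _) = pendants⁺ (centres ps) (leaves ps)
    (leaves-unique ps M)
    (nonAdjacent (All.map⁺ (All.map proj₁ matched)))
    (All.map⁺ (All.zipWith (λ ((Ix , _) , unique) → outside Ix , unique)
                           (matched , leaves-uniqueNeighbour ps M)))
    where
    outside : ∀ {x} → I x ≡ true → x ∉ centres ps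
    outside Ix x∈U with ∈-map⁻ proj₁ x∈U
    ... | p , p∈ps , refl with trans (sym Ix) (proj₁ (proj₂ (All.lookup matched p∈ps)))
    ...   | ()

  Dominates : List (Fin n) → Set
  Dominates L = ∀ x → I x ≡ true → Any (λ u → adj G x u ≡ true) L

  dominates? : ∀ L → Dominates L ⊎ Σ (Fin n) λ x → I x ≡ true × All (NonAdjacent x) L
  dominates? L with any? (λ x → (I x ≟ᵇ true) ×-dec ¬? (Any.any? (λ u → adj G x u ≟ᵇ true) L))
  ... | yes (x , Ix , undominated) = inj₂ (x , Ix , All.map ¬-not (¬Any⇒All¬ L undominated))
  ... | no  none = inj₁ λ x Ix →
    decidable-stable (Any.any? (λ u → adj G x u ≟ᵇ true) L) (λ undominated → none (x , Ix , undominated))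

  -- R are candidate centres still to be examined. A candidate r is discarded if
  -- the other centres still dominate I; otherwise some x ∈ I is dominated by r
  -- alone, and (r , x) joins the matching.
  extractMatching : ∀ K R → PrivateMatching K → All (λ u → I u ≡ false) R →
    All (λ p → All (NonAdjacent (proj₂ p)) R) K → Dominates (centres K ++ R) →
    Σ (List (Fin n × Fin n)) λ ps → PrivateMatching ps × Dominates (centres ps)
  extractMatching K []      M _ _ dom = K , M , subst Dominates (++-identityʳ (centres K)) dom
  extractMatching K (r ∷ R) M@(matched , privs) (r∉I ∷ R∉I) K≁rR dom with dominates? (centres K ++ R)
  ... | inj₁ dom′ = extractMatching K R M R∉I (All.map All.tail K≁rR) dom′
  ... | inj₂ (x , Ix , x≁KR) =
    extractMatching ((r , x) ∷ K) R
      ( (Ix , r∉I , x~r) ∷ matched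
      , All.zipWith (λ (x≁u′ , x′≁rR) → x≁u′ , All.head x′≁rR) (x≁K , K≁rR) ∷ privs)
      R∉I (x≁R ∷ All.map All.tail K≁rR) dom′
    where
    x≁K : All (λ p → adj G x (proj₁ p) ≡ false) K
    x≁K = All.map⁻ (All.++⁻ˡ (centres K) x≁KR)
    x≁R : All (NonAdjacent x) R
    x≁R = All.++⁻ʳ (centres K) x≁KR
    x~r : adj G x r ≡ true
    x~r with Any.++⁻ (centres K) (dom x Ix)
    ... | inj₁ x~K         = ⊥-elim (¬Any-adjacent (All.++⁻ˡ (centres K) x≁KR) x~K)
    ... | inj₂ (here x~r)  = x~r
    ... | inj₂ (there x~R) = ⊥-elim (¬Any-adjacent x≁R x~R)
    dom′ : Dominates (r ∷ centres K ++ R)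
    dom′ y Iy with Any.++⁻ (centres K) (dom y Iy)
    ... | inj₁ y~K         = there (Any.++⁺ˡ y~K)
    ... | inj₂ (here y~r)  = here y~r
    ... | inj₂ (there y~R) = there (Any.++⁺ʳ (centres K) y~R)

  privateMatching : (∀ v → ¬ Isolated G v) →
    Σ (List (Fin n × Fin n)) λ ps → PrivateMatching ps × Dominates (centres ps)
  privateMatching noIsolated = extractMatching [] outside ([] , []) (all-filter outside? (allFin n)) [] dom
    where
    outside? : ∀ u → Dec (I u ≡ false)
    outside? u = I u ≟ᵇ false
    outside : List (Fin n)
    outside = filter outside? (allFin n)
    dom : Dominates outside
    dom x Ix with ¬∀⟶∃¬ n (NonAdjacent x) (λ u → adj G x u ≟ᵇ false) (noIsolated x)
    ... | u , ¬x≁u = lose (∈-filter⁺ outside? (∈-allFin u) u∉I) x~u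
      where
      x~u : adj G x u ≡ true
      x~u = ¬-not ¬x≁u
      u∉I : I u ≡ false
      u∉I = ¬-not λ Iu → true≢false (trans (sym x~u) (independent x u Ix Iu))

  covered-count : ∀ L → ∑ (λ x → b2n (I x ∧ any (adj G x) L)) ≤ sum (map (neighboursIn I) L)
  covered-count []      = ≤-reflexive (∑-zero {n} λ x → cong b2n (∧-zeroʳ (I x)))
  covered-count (u ∷ L) = begin
    ∑ (λ x → b2n (I x ∧ (adj G x u ∨ any (adj G x) L)))
      ≤⟨ ∑-mono-≤ (λ x → b2n-∧∨ (I x) (adj G x u) _) ⟩
    ∑ (λ x → b2n (I x ∧ adj G x u) + b2n (I x ∧ any (adj G x) L))
      ≡⟨ ∑-distrib-+ {n} _ _ ⟩
    ∑ (λ x → b2n (I x ∧ adj G x u)) + ∑ (λ x → b2n (I x ∧ any (adj G x) L))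
      ≤⟨ +-mono-≤ (≤-reflexive (sum-cong-≗ {n} λ x → cong (λ b → b2n (I x ∧ b)) (adj-sym G x u)))
                  (covered-count L) ⟩
    neighboursIn I u + sum (map (neighboursIn I) L) ∎
    where open ≤-Reasoning

  any-adjacent : ∀ {x L} → Any (λ u → adj G x u ≡ true) L → any (adj G x) L ≡ true
  any-adjacent {x} {u ∷ L} (here x~u)  = cong (_∨ any (adj G x) L) x~u
  any-adjacent {x} {u ∷ L} (there x~L) = trans (cong (adj G x u ∨_) (any-adjacent x~L)) (∨-zeroʳ _)

  dominated-count : ∀ L → Dominates L → ∑ (b2n ∘ I) ≤ sum (map (neighboursIn I) L)
  dominated-count L dom = ≤-trans (∑-mono-≤ covered) (covered-count L)
    where
    covered : ∀ x → b2n (I x) ≤ b2n (I x ∧ any (adj G x) L)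
    covered x with I x in Ix
    ... | false = z≤n
    ... | true  = ≤-reflexive (cong b2n (sym (any-adjacent (dom x Ix))))

  dominating-length : ∀ {d L} → (∀ u → neighboursIn I u ≤ d) → ∑ (b2n ∘ I) ≡ d * d + 1 →
                      Dominates L → d < length L
  dominating-length {d} {L} deg≤d size dom = *-cancelʳ-< d d (length L) (begin-strict
    d * d                             <⟨ m<m+n (d * d) z<s ⟩
    d * d + 1                         ≡⟨ sym size ⟩
    ∑ (b2n ∘ I)                       ≤⟨ dominated-count L dom ⟩
    sum (map (neighboursIn I) L)      ≤⟨ sum-map-≤ deg≤d L ⟩
    length L * d                      ∎)
    where open ≤-Reasoning

  matching-reach : ∀ {k} ps → PrivateMatching ps → k ≤ length (centres ps) →
                   Σ (List (Fin n)) λ L → edgesOf L ≡ k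
  matching-reach {k} ps (matched , privs) k≤ps
    with straddlingSuffix (centres ps) (≤-trans k≤ps (m≤n+m _ _))
  ... | i , lo , hi rewrite drop-map {f = proj₁} i ps =
    pendants-reach (centres (drop i ps)) (leaves (drop i ps))
      (pendants-of-matching (drop i ps) (All.drop⁺ i matched , AllPairs.drop⁺ i privs))
      lo
      (subst (λ m → k ≤ edgesOf (centres (drop i ps)) + m)
             (trans (length-map proj₁ (drop i ps)) (sym (length-map proj₂ (drop i ps)))) hi)

lemma3p9 : (k n : ℕ) → 1 ≤ k → (G : Graph n)
    → (∀ v → ¬ Isolated G v)
    → (Σ (Subset n) λ I → Independent G I × ∣ I ∣ ≡ (k ∸ 1) * (k ∸ 1) + 1)
    → Σ (Subset n) λ S → Nonempty S × edgesInduced G S ≡ k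
lemma3p9 zero    _ () _ _ _
lemma3p9 (suc d) n _  G noIsolated (I , I-independent , size) = subset-fromList (proj₁ reach) (proj₂ reach)
  where
  open EdgeCount G
  open IndependentSet G (lookup I)
    (λ u v Iu Iv → I-independent u v (lookup⇒[]= u I Iu) (lookup⇒[]= v I Iv))
  reach : Σ (List (Fin n)) λ L → edgesOf L ≡ suc d
  reach with any? (λ u → suc d ≤? neighboursIn (lookup I) u)
  ... | yes (u , k≤deg) = star-reach u k≤deg
  ... | no  allSmall     with privateMatching noIsolated
  ...   | ps , M , dom   = matching-reach ps M (dominating-length deg≤d (trans (sym (∣p∣≡∑ I)) size) dom)
    where
    deg≤d : ∀ u → neighboursIn (lookup I) u ≤ d
    deg≤d u = s≤s⁻¹ (≰⇒> λ k≤deg → allSmall (u , k≤deg))
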